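{- Let $\mathbf{P}=(P,\leq)$ be a finite nonempty poset (a solvable instance of bounded distributive lattice unification). Then $\mathrm{type}_{\mathcal{BDL}}(\mathbf{P})=1$ if and only if $\mathbf{P}$ is a lattice; $\mathrm{type}_{\mathcal{BDL}}(\mathbf{P})=\omega$ if and only if $\mathbf{P}$ is not a lattice but the interval $[x,y]=\{z\in P\mid x\leq z\leq y\}$ (with inherited order) is a lattice for all $x\leq y$ in $P$; and $\mathrm{type}_{\mathcal{BDL}}(\mathbf{P})=0$ otherwise.
   Context: For a finite poset $\mathbf{P}$, a unifier for $\mathbf{P}$ is a monotone map $u\colon\mathbf{L}\to\mathbf{P}$ where $\mathbf{L}$ is a finite nonempty lattice; $\mathbf{P}$ is solvable iff it has a unifier, i.e. iff $P\neq\emptyset$. For unifiers $u_1\colon\mathbf{L}_1\to\mathbf{P}$, $u_2\colon\mathbf{L}_2\to\mathbf{P}$, write $u_2\leq u_1$ if there is a monotone map $f\colon\mathbf{L}_2\to\mathbf{L}_1$ with $u_1\circ f=u_2$; $\mathrm{type}_{\mathcal{BDL}}(\mathbf{P})$ is the type of the resulting preordered class of unifiers (by Birkhoff duality this is the unification type of the bounded distributive lattice of downsets of $\mathbf{P}$). For a preorder, a $\mu$-set is a subset whose distinct elements are pairwise incomparable and such that every element lies below some element of it. The type is: $0$ (nullary) if there is no $\mu$-set; $\infty$ if there is an infinite $\mu$-set; $\omega$ if there is a finite $\mu$-set of cardinality greater than $1$; $1$ if there is a $\mu$-set of cardinality $1$. -}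

module Defs where

open import Level using (0ℓ)
open import Data.Nat using (ℕ; _≥_)
open import Data.Fin using (Fin)
open import Data.Product using (Σ; ∃; _×_; _,_)
open import Data.Unit using (⊤)
open import Relation.Nullary using (¬_)
open import Relation.Binary.Core using (Rel)
open import Relation.Binary.Definitions using (Decidable)
open import Relation.Binary.Structures using (IsPartialOrder)
open import Relation.Binary.PropositionalEquality using (_≡_)
open import Function.Bundles using (_↔_)

record FinPoset : Set₁ where
  field
    size    : ℕ
    _≤_     : Rel (Fin size) 0ℓ
    isPO    : IsPartialOrder _≡_ _≤_
    _≤?_    : Decidable _≤_

open FinPoset public

Carrier : FinPoset → Set
Carrier P = Fin (size P)

NonEmpty : FinPoset → Set
NonEmpty P = Carrier P

module _ (P : FinPoset) where
  private
    _≤P_ = _≤_ P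

  IsJoinIn : (S : Carrier P → Set) → Carrier P → Carrier P → Carrier P → Set
  IsJoinIn S a b z =
    S z × a ≤P z × b ≤P z ×
    (∀ w → S w → a ≤P w → b ≤P w → z ≤P w)

  IsMeetIn : (S : Carrier P → Set) → Carrier P → Carrier P → Carrier P → Set
  IsMeetIn S a b z =
    S z × z ≤P a × z ≤P b ×
    (∀ w → S w → w ≤P a → w ≤P b → w ≤P z)

  IsLatticeOn : (Carrier P → Set) → Set
  IsLatticeOn S =
    ∀ a b → S a → S b → (∃ λ z → IsJoinIn S a b z) × (∃ λ z → IsMeetIn S a b z)

IsLattice : FinPoset → Set
IsLattice P = IsLatticeOn P (λ _ → ⊤)

Interval : (P : FinPoset) → Carrier P → Carrier P → Carrier P → Set
Interval P x y z = _≤_ P x z × _≤_ P z y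

IntervalsAreLattices : FinPoset → Set
IntervalsAreLattices P =
  ∀ x y → _≤_ P x y → IsLatticeOn P (Interval P x y)

Monotone : (P Q : FinPoset) → (Carrier P → Carrier Q) → Set
Monotone P Q f = ∀ a b → _≤_ P a b → _≤_ Q (f a) (f b)

record Unifier (P : FinPoset) : Set₁ where
  field
    L        : FinPoset
    lattice  : IsLattice L
    nonempty : NonEmpty L
    map      : Carrier L → Carrier P
    monotone : Monotone L P map

open Unifier public

_≼_ : {P : FinPoset} → Unifier P → Unifier P → Set
_≼_ u₂ u₁ =
  Σ (Carrier (L u₂) → Carrier (L u₁)) λ f →
    Monotone (L u₂) (L u₁) f × (∀ x → map u₁ (f x) ≡ map u₂ x)

-- μ-sets, given as families indexed by a type I.  "Distinct elements are
-- pairwise incomparable": μ i ≼ μ j forces i ≡ j (this also makes the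
-- family injective, so it is really a subset).

IsMuSet : {P : FinPoset} {I : Set} → (I → Unifier P) → Set₁
IsMuSet {P} {I} μ =
  (∀ i j → μ i ≼ μ j → i ≡ j) × (∀ (u : Unifier P) → ∃ λ i → u ≼ μ i)

IsFinite : Set → Set
IsFinite I = ∃ λ k → I ↔ Fin k

Type0 : FinPoset → Set₁
Type0 P = ¬ (Σ Set λ I → Σ (I → Unifier P) λ μ → IsMuSet μ)

Type∞ : FinPoset → Set₁
Type∞ P = Σ Set λ I → Σ (I → Unifier P) λ μ → IsMuSet μ × ¬ IsFinite I

Typeω : FinPoset → Set₁
Typeω P = Σ Set λ I → Σ (I → Unifier P) λ μ → IsMuSet μ ×
            (Σ ℕ λ k → k ≥ 2 × (I ↔ Fin k))

Type1 : FinPoset → Set₁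
Type1 P = Σ Set λ I → Σ (I → Unifier P) λ μ → IsMuSet μ × (I ↔ Fin 1)

module Submission where

-- If some interval [x, y] contains a, b
-- with upper bounds c, d in it and nothing between a, b and both c, d, then P
-- has no μ-set: gluing the lattice Mₙ × Mₙ, labelled by x, a, b, c, d, y,
-- onto a member ν above the chain x < y gives a unifier above ν that cannot
-- factor back through ν once n exceeds the size of ν's lattice.  Taking c
-- minimal and d a minimal upper bound not above c, every μ-set therefore
-- forces all intervals to be lattices (joins directly, meets by duality).
--
-- If all intervals are lattices, the
-- interval unifiers of the intervals [p, q] with p minimal and q maximal form
-- a μ-set; it has a single member exactly when P is a lattice.
--
-- Since a lattice is its own most general unifier and a one-element μ-set
-- forces every μ-set to have one element, the three equivalences follow
-- (module Classification, then theorem15).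

open import Defs
open import Data.Nat as ℕ using (ℕ; zero; suc; _≥_)
import Data.Nat.Properties as ℕP
open import Data.Product using (_×_; Σ; ∃; _,_; proj₁; proj₂; swap)
open import Data.Sum using (_⊎_; inj₁; inj₂)
open import Data.Unit using (⊤; tt)
open import Data.Empty using (⊥; ⊥-elim)
open import Relation.Nullary using (¬_; Dec; yes; no; Irrelevant)
open import Relation.Nullary.Decidable using (_×-dec_; _→-dec_; ¬?; decidable-stable)
import Relation.Unary as U
open import Relation.Binary.PropositionalEquality
  using (_≡_; refl; sym; trans; cong; cong₂; subst; isEquivalence)
open import Relation.Binary.Structures using (IsPartialOrder)
import Relation.Binary.Construct.NonStrictToStrict as ToStrict
open import Induction.WellFounded using (Acc; acc)
open import Data.Fin as F using (Fin; zero; suc)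
import Data.Fin.Properties as FP
open import Data.Fin.Induction using (po-wellFounded)
open import Data.List using (List; length; lookup; filter; cartesianProduct; allFin)
import Data.List.Relation.Unary.All as All
import Data.List.Relation.Unary.Any as Any
open import Data.List.Relation.Unary.Any.Properties using (lookup-index)
import Data.List.Relation.Unary.AllPairs as AllPairs
open import Data.List.Relation.Unary.Unique.Propositional using (Unique)
import Data.List.Relation.Unary.Unique.Propositional.Properties as Unique
open import Data.List.Membership.Propositional.Properties
  using (∈-allFin; ∈-filter⁺; ∈-filter⁻; ∈-cartesianProduct⁺; ∈-lookup)
open import Function.Bundles using (_⇔_; mk⇔; _↔_; Inverse; mk↔ₛ′)
open import Function.Properties.Inverse using (↔-sym)

module PO (P : FinPoset) where
  ≤-refl : ∀ {a} → _≤_ P a a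
  ≤-refl = IsPartialOrder.refl (isPO P)

  ≤-trans : ∀ {a b c} → _≤_ P a b → _≤_ P b c → _≤_ P a c
  ≤-trans = IsPartialOrder.trans (isPO P)

  ≤-antisym : ∀ {a b} → _≤_ P a b → _≤_ P b a → a ≡ b
  ≤-antisym = IsPartialOrder.antisym (isPO P)

_ᵒᵖ : FinPoset → FinPoset
P ᵒᵖ = record
  { size = size P
  ; _≤_ = λ a b → _≤_ P b a
  ; isPO = record
    { isPreorder = record
      { isEquivalence = IsPartialOrder.isEquivalence (isPO P)
      ; reflexive = λ a≡b → IsPartialOrder.reflexive (isPO P) (sym a≡b)
      ; trans = λ p q → IsPartialOrder.trans (isPO P) q p }
    ; antisym = λ p q → IsPartialOrder.antisym (isPO P) q p }
  ; _≤?_ = λ a b → _≤?_ P b a }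

ᵒᵖ-lattice : (L : FinPoset) → IsLattice L → IsLattice (L ᵒᵖ)
ᵒᵖ-lattice L lat a b sa sb = swap (lat a b sa sb)

IsMinimalIn : (P : FinPoset) → (Carrier P → Set) → Carrier P → Set
IsMinimalIn P S m = S m × (∀ z → S z → _≤_ P z m → z ≡ m)

minimalBelow : (P : FinPoset) (S : Carrier P → Set) → U.Decidable S →
  ∀ s → S s → ∃ λ m → IsMinimalIn P S m × _≤_ P m s
minimalBelow P S S? s₀ = descend s₀ (po-wellFounded (isPO P) s₀)
  where
  open PO P
  descend : ∀ s → Acc (ToStrict._<_ _≡_ (_≤_ P)) s → S s → ∃ λ m → IsMinimalIn P S m × _≤_ P m s
  descend s (acc below) Ss
    with FP.any? (λ z → S? z ×-dec _≤?_ P z s ×-dec ¬? (z F.≟ s))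
  ... | yes (z , Sz , z≤s , z≢s) =
    let (m , minimal , m≤z) = descend z (below (z≤s , z≢s)) Sz
    in m , minimal , ≤-trans m≤z z≤s
  ... | no nothingBelow = s , (Ss , onlyItself) , ≤-refl
    where
    onlyItself : ∀ z → S z → _≤_ P z s → z ≡ s
    onlyItself z Sz z≤s =
      decidable-stable (z F.≟ s) (λ z≢s → nothingBelow (z , Sz , z≤s , z≢s))

IsMinimal : (P : FinPoset) → Carrier P → Set
IsMinimal P m = ∀ z → _≤_ P z m → z ≡ m

IsMaximal : (P : FinPoset) → Carrier P → Set
IsMaximal P = IsMinimal (P ᵒᵖ)

minimalElementBelow : (P : FinPoset) → ∀ s → ∃ λ m → IsMinimal P m × _≤_ P m s
minimalElementBelow P s =
  let (m , (_ , minimal) , m≤s) = minimalBelow P (λ _ → ⊤) (λ _ → yes tt) s tt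
  in m , (λ z → minimal z tt) , m≤s

everywhere-lattice : (P : FinPoset) {S : Carrier P → Set} → (∀ z → S z) → IsLatticeOn P S → IsLattice P
everywhere-lattice P all-S lat a b _ _ with lat a b (all-S a) (all-S b)
... | (j , _ , a≤j , b≤j , least) , (m , _ , m≤a , m≤b , greatest) =
  (j , tt , a≤j , b≤j , λ w _ → least w (all-S w)) , (m , tt , m≤a , m≤b , λ w _ → greatest w (all-S w))

-- A nonempty finite lattice has a top element: a maximal element m is above
-- every z, because the join of z and m must equal m.
latticeTop : (L : FinPoset) → IsLattice L → Carrier L → ∃ λ t → ∀ z → _≤_ L z t
latticeTop L lat e = m , λ z → below z (proj₁ (lat z m tt tt))
  where
  m = proj₁ (minimalElementBelow (L ᵒᵖ) e)
  m-maximal : IsMaximal L m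
  m-maximal = proj₁ (proj₂ (minimalElementBelow (L ᵒᵖ) e))
  below : ∀ z → ∃ (IsJoinIn L (λ _ → ⊤) z m) → _≤_ L z m
  below z (j , _ , z≤j , m≤j , _) = subst (_≤_ L z) (m-maximal j m≤j) z≤j

latticeBottom : (L : FinPoset) → IsLattice L → Carrier L → ∃ λ t → ∀ z → _≤_ L t z
latticeBottom L lat = latticeTop (L ᵒᵖ) (ᵒᵖ-lattice L lat)

comparable-lattice : (P : FinPoset) {a b : Carrier P} → _≤_ P a b ⊎ _≤_ P b a →
  ∃ (IsJoinIn P (λ _ → ⊤) a b) × ∃ (IsMeetIn P (λ _ → ⊤) a b)
comparable-lattice P {a} {b} (inj₁ a≤b) =
  (b , tt , a≤b , ≤-refl , λ _ _ _ b≤w → b≤w) , (a , tt , ≤-refl , a≤b , λ _ _ w≤a _ → w≤a)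
  where open PO P
comparable-lattice P {a} {b} (inj₂ b≤a) =
  (a , tt , ≤-refl , b≤a , λ _ _ a≤w _ → a≤w) , (b , tt , b≤a , ≤-refl , λ _ _ _ w≤b → w≤b)
  where open PO P

chain : ℕ → FinPoset
chain n = record { size = n ; _≤_ = F._≤_ ; isPO = FP.≤-isPartialOrder ; _≤?_ = FP._≤?_ }

chain-lattice : ∀ n → IsLattice (chain n)
chain-lattice n a b _ _ = comparable-lattice (chain n) (FP.≤-total a b)

-- The flat lattice Mₙ on Fin (2 + n): a bottom, a top and n pairwise
-- incomparable atoms in between.
pattern bot = zero
pattern top = suc zero
pattern atom i = suc (suc i)

_⊑ₘ_ : ∀ {n} → Fin (suc (suc n)) → Fin (suc (suc n)) → Set
bot ⊑ₘ _ = ⊤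
top ⊑ₘ top = ⊤
atom _ ⊑ₘ top = ⊤
atom i ⊑ₘ atom j = i ≡ j
_ ⊑ₘ _ = ⊥

⊑ₘ-refl : ∀ {n} (a : Fin (suc (suc n))) → a ⊑ₘ a
⊑ₘ-refl bot = tt
⊑ₘ-refl top = tt
⊑ₘ-refl (atom i) = refl

⊑ₘ-top : ∀ {n} (a : Fin (suc (suc n))) → a ⊑ₘ top
⊑ₘ-top bot = tt
⊑ₘ-top top = tt
⊑ₘ-top (atom i) = tt

⋢bot : ∀ {n} (p : Fin (suc n)) → ¬ (suc p ⊑ₘ bot)
⋢bot zero ()
⋢bot (suc _) ()

⊑ₘ-trans : ∀ {n} (a b c : Fin (suc (suc n))) → a ⊑ₘ b → b ⊑ₘ c → a ⊑ₘ c
⊑ₘ-trans bot b c _ _ = tt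
⊑ₘ-trans a b top _ _ = ⊑ₘ-top a
⊑ₘ-trans (atom i) (atom j) (atom k) i≡j j≡k = trans i≡j j≡k
⊑ₘ-trans top top bot _ ()
⊑ₘ-trans top top (atom _) _ ()
⊑ₘ-trans (atom _) top bot _ ()
⊑ₘ-trans (atom _) top (atom _) _ ()
⊑ₘ-trans (atom _) (atom _) bot _ ()

⊑ₘ-antisym : ∀ {n} (a b : Fin (suc (suc n))) → a ⊑ₘ b → b ⊑ₘ a → a ≡ b
⊑ₘ-antisym bot bot _ _ = refl
⊑ₘ-antisym bot top _ ()
⊑ₘ-antisym bot (atom _) _ ()
⊑ₘ-antisym top top _ _ = refl
⊑ₘ-antisym (atom i) (atom j) refl _ = refl

_⊑ₘ?_ : ∀ {n} (a b : Fin (suc (suc n))) → Dec (a ⊑ₘ b)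
bot ⊑ₘ? _ = yes tt
top ⊑ₘ? bot = no λ ()
top ⊑ₘ? top = yes tt
top ⊑ₘ? atom _ = no λ ()
atom _ ⊑ₘ? bot = no λ ()
atom _ ⊑ₘ? top = yes tt
atom i ⊑ₘ? atom j = i F.≟ j

flat : ℕ → FinPoset
flat n = record
  { size = suc (suc n)
  ; _≤_ = _⊑ₘ_
  ; isPO = record
    { isPreorder = record
      { isEquivalence = isEquivalence
      ; reflexive = λ { {a} refl → ⊑ₘ-refl a }
      ; trans = λ {a} {b} {c} → ⊑ₘ-trans a b c }
    ; antisym = λ {a} {b} → ⊑ₘ-antisym a b }
  ; _≤?_ = _⊑ₘ?_ }

flat-lattice : ∀ n → IsLattice (flat n)
flat-lattice n bot b _ _ = comparable-lattice (flat n) (inj₁ tt)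
flat-lattice n top b _ _ = comparable-lattice (flat n) (inj₂ (⊑ₘ-top b))
flat-lattice n (atom i) bot _ _ = comparable-lattice (flat n) (inj₂ tt)
flat-lattice n (atom i) top _ _ = comparable-lattice (flat n) (inj₁ tt)
flat-lattice n (atom i) (atom j) _ _ with i F.≟ j
... | yes refl = comparable-lattice (flat n) (inj₁ refl)
... | no i≢j = (top , tt , tt , tt , join-least) , (bot , tt , tt , tt , meet-greatest)
  where
  join-least : ∀ w → ⊤ → atom i ⊑ₘ w → atom j ⊑ₘ w → top ⊑ₘ w
  join-least top _ _ _ = tt
  join-least (atom k) _ i≡k j≡k = ⊥-elim (i≢j (trans i≡k (sym j≡k)))
  meet-greatest : ∀ w → ⊤ → w ⊑ₘ atom i → w ⊑ₘ atom j → w ⊑ₘ bot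
  meet-greatest bot _ _ _ = tt
  meet-greatest (atom k) _ k≡i k≡j = ⊥-elim (i≢j (trans (sym k≡i) k≡j))

module Product (A B : FinPoset) where
  private
    module A = PO A
    module B = PO B

  components : Fin (size A ℕ.* size B) → Carrier A × Carrier B
  components = F.remQuot (size B)

  pair : Carrier A → Carrier B → Fin (size A ℕ.* size B)
  pair = F.combine

  components-pair : ∀ a b → components (pair a b) ≡ (a , b)
  components-pair = FP.remQuot-combine

  components-injective : ∀ z w → components z ≡ components w → z ≡ w
  components-injective z w eq =
    trans (sym (FP.combine-remQuot {size A} (size B) z))
      (trans (cong (λ p → pair (proj₁ p) (proj₂ p)) eq) (FP.combine-remQuot {size A} (size B) w))

  _≤×_ : Carrier A × Carrier B → Carrier A × Carrier B → Set
  (a , b) ≤× (a' , b') = _≤_ A a a' × _≤_ B b b'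

  poset : FinPoset
  poset = record
    { size = size A ℕ.* size B
    ; _≤_ = λ z w → components z ≤× components w
    ; isPO = record
      { isPreorder = record
        { isEquivalence = isEquivalence
        ; reflexive = λ { refl → A.≤-refl , B.≤-refl }
        ; trans = λ (p , q) (p' , q') → A.≤-trans p p' , B.≤-trans q q' }
      ; antisym = λ {z} {w} (p , q) (p' , q') →
          components-injective z w (cong₂ _,_ (A.≤-antisym p p') (B.≤-antisym q q')) }
    ; _≤?_ = λ z w → _≤?_ A (proj₁ (components z)) (proj₁ (components w))
                ×-dec _≤?_ B (proj₂ (components z)) (proj₂ (components w)) }

  ≤-pair : ∀ z a b → components z ≤× (a , b) → _≤_ poset z (pair a b)
  ≤-pair z a b = subst (components z ≤×_) (sym (components-pair a b))

  pair-≤ : ∀ z a b → (a , b) ≤× components z → _≤_ poset (pair a b) z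
  pair-≤ z a b = subst (_≤× components z) (sym (components-pair a b))

  pair-mono : ∀ {a b a' b'} → _≤_ A a a' → _≤_ B b b' → _≤_ poset (pair a b) (pair a' b')
  pair-mono {a} {b} {a'} {b'} a≤a' b≤b' =
    pair-≤ (pair a' b') a b (subst ((a , b) ≤×_) (sym (components-pair a' b')) (a≤a' , b≤b'))

  isLattice : IsLattice A → IsLattice B → IsLattice poset
  isLattice latA latB z w _ _ = join (proj₁ boundsA) (proj₁ boundsB) , meet (proj₂ boundsA) (proj₂ boundsB)
    where
    boundsA = latA (proj₁ (components z)) (proj₁ (components w)) tt tt
    boundsB = latB (proj₂ (components z)) (proj₂ (components w)) tt tt
    join : ∃ (IsJoinIn A (λ _ → ⊤) _ _) → ∃ (IsJoinIn B (λ _ → ⊤) _ _) →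
           ∃ (IsJoinIn poset (λ _ → ⊤) z w)
    join (a , _ , a₁ , a₂ , a-least) (b , _ , b₁ , b₂ , b-least) =
      pair a b , tt , ≤-pair z a b (a₁ , b₁) , ≤-pair w a b (a₂ , b₂) ,
      λ v _ (za , zb) (wa , wb) → pair-≤ v a b (a-least _ tt za wa , b-least _ tt zb wb)
    meet : ∃ (IsMeetIn A (λ _ → ⊤) _ _) → ∃ (IsMeetIn B (λ _ → ⊤) _ _) →
           ∃ (IsMeetIn poset (λ _ → ⊤) z w)
    meet (a , _ , a₁ , a₂ , a-greatest) (b , _ , b₁ , b₂ , b-greatest) =
      pair a b , tt , pair-≤ z a b (a₁ , b₁) , pair-≤ w a b (a₂ , b₂) ,
      λ v _ (za , zb) (wa , wb) → ≤-pair v a b (a-greatest _ tt za wa , b-greatest _ tt zb wb)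

≼-trans : ∀ {P : FinPoset} {u v w : Unifier P} → u ≼ v → v ≼ w → u ≼ w
≼-trans (f , f-mono , f-comm) (g , g-mono , g-comm) =
  (λ z → g (f z)) , (λ a b a≤b → g-mono _ _ (f-mono a b a≤b)) ,
  λ z → trans (g-comm (f z)) (f-comm z)

HasMuSet : FinPoset → Set₁
HasMuSet P = Σ Set λ I → Σ (I → Unifier P) IsMuSet

dualUnifier : ∀ {P : FinPoset} → Unifier P → Unifier (P ᵒᵖ)
dualUnifier u = record
  { L = L u ᵒᵖ ; lattice = ᵒᵖ-lattice (L u) (lattice u) ; nonempty = nonempty u
  ; map = map u ; monotone = λ a b b≤a → monotone u b a b≤a }

undualUnifier : ∀ {P : FinPoset} → Unifier (P ᵒᵖ) → Unifier P
undualUnifier u = record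
  { L = L u ᵒᵖ ; lattice = ᵒᵖ-lattice (L u) (lattice u) ; nonempty = nonempty u
  ; map = map u ; monotone = λ a b b≤a → monotone u b a b≤a }

dualMuSet : ∀ {P : FinPoset} → HasMuSet P → HasMuSet (P ᵒᵖ)
dualMuSet (I , μ , incomparable , complete) =
  I , (λ i → dualUnifier (μ i)) ,
  (λ i j (f , f-mono , f-comm) → incomparable i j (f , (λ a b b≤a → f-mono b a b≤a) , f-comm)) ,
  λ u → let (i , f , f-mono , f-comm) = complete (undualUnifier u)
        in i , f , (λ a b b≤a → f-mono b a b≤a) , f-comm

-- The forbidden configuration: x ≤ a, b ≤ c, d ≤ y with no element lying
-- above both a, b and below both c, d (so a, b have no join in [x, y]).
module Obstruction (P : FinPoset) (x a b c d y : Carrier P)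
  (x≤a : _≤_ P x a) (x≤b : _≤_ P x b) (a≤c : _≤_ P a c) (b≤c : _≤_ P b c)
  (a≤d : _≤_ P a d) (b≤d : _≤_ P b d) (c≤y : _≤_ P c y) (d≤y : _≤_ P d y)
  (separated : ∀ z → _≤_ P a z → _≤_ P b z → _≤_ P z c → _≤_ P z d → ⊥) where

  open PO P
  private
    _⊑_ = _≤_ P

  x≤y : x ⊑ y
  x≤y = ≤-trans x≤a (≤-trans a≤c c≤y)

  cOrD : ∀ {n} → Fin n → Fin n → Carrier P
  cOrD i j with i F.<? j
  ... | yes _ = c
  ... | no _ = d

  cOrD-elim : ∀ {n} (Q : Carrier P → Set) → Q c → Q d → (i j : Fin n) → Q (cOrD i j)
  cOrD-elim Q Qc Qd i j with i F.<? j
  ... | yes _ = Qc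
  ... | no _ = Qd

  cOrD-< : ∀ {n} {i j : Fin n} → i F.< j → cOrD i j ≡ c
  cOrD-< {i = i} {j} i<j with i F.<? j
  ... | yes _ = refl
  ... | no i≮j = ⊥-elim (i≮j i<j)

  cOrD-diag : ∀ {n} (i : Fin n) → cOrD i i ≡ d
  cOrD-diag i with i F.<? i
  ... | yes i<i = ⊥-elim (FP.<-irrefl refl i<i)
  ... | no _ = refl

  label : ∀ {n} → Fin (suc (suc n)) → Fin (suc (suc n)) → Carrier P
  label bot bot = x
  label bot (suc _) = b
  label (suc _) bot = a
  label top (suc _) = y
  label (atom _) top = y
  label (atom i) (atom j) = cOrD i j

  x≤label : ∀ {n} (p q : Fin (suc (suc n))) → x ⊑ label p q
  x≤label bot bot = ≤-refl
  x≤label bot (suc _) = x≤b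
  x≤label (suc _) bot = x≤a
  x≤label top (suc _) = x≤y
  x≤label (atom _) top = x≤y
  x≤label (atom i) (atom j) = cOrD-elim (x ⊑_) (≤-trans x≤a a≤c) (≤-trans x≤a a≤d) i j

  b≤label : ∀ {n} (p : Fin (suc (suc n))) (q : Fin (suc n)) → b ⊑ label p (suc q)
  b≤label bot _ = ≤-refl
  b≤label top _ = ≤-trans b≤c c≤y
  b≤label (atom _) zero = ≤-trans b≤c c≤y
  b≤label (atom i) (suc j) = cOrD-elim (b ⊑_) b≤c b≤d i j

  a≤label : ∀ {n} (p : Fin (suc n)) (q : Fin (suc (suc n))) → a ⊑ label (suc p) q
  a≤label _ bot = ≤-refl
  a≤label zero (suc _) = ≤-trans a≤c c≤y
  a≤label (suc _) top = ≤-trans a≤c c≤y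
  a≤label (suc i) (atom j) = cOrD-elim (a ⊑_) a≤c a≤d i j

  label≤y : ∀ {n} (p q : Fin (suc (suc n))) → label p q ⊑ y
  label≤y bot bot = x≤y
  label≤y bot (suc _) = ≤-trans b≤c c≤y
  label≤y (suc _) bot = ≤-trans a≤c c≤y
  label≤y top (suc _) = ≤-refl
  label≤y (atom _) top = ≤-refl
  label≤y (atom i) (atom j) = cOrD-elim (_⊑ y) c≤y d≤y i j

  label-mono : ∀ {n} (p q p' q' : Fin (suc (suc n))) → p ⊑ₘ p' → q ⊑ₘ q' → label p q ⊑ label p' q'
  label-mono bot bot p' q' _ _ = x≤label p' q'
  label-mono bot (suc q) p' (suc q') _ _ = b≤label p' q'
  label-mono (suc p) bot (suc p') q' _ _ = a≤label p' q'
  label-mono (suc p) (suc q) top (suc q') _ _ = label≤y (suc p) (suc q)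
  label-mono (suc p) (suc q) (atom _) top _ _ = label≤y (suc p) (suc q)
  label-mono (atom i) (atom j) (atom i) (atom j) refl refl = ≤-refl
  label-mono bot (suc q) _ bot _ q⊑bot = ⊥-elim (⋢bot q q⊑bot)
  label-mono (suc p) _ bot _ p⊑bot _ = ⊥-elim (⋢bot p p⊑bot)
  label-mono (suc _) (suc q) _ bot _ q⊑bot = ⊥-elim (⋢bot q q⊑bot)

  module Gadget (n : ℕ) where
    module G = Product (flat n) (flat n)

    γ : Carrier G.poset → Carrier P
    γ k = label (proj₁ (G.components k)) (proj₂ (G.components k))

    γ-mono : Monotone G.poset P γ
    γ-mono k k' (p , q) =
      label-mono (proj₁ (G.components k)) (proj₂ (G.components k))
                 (proj₁ (G.components k')) (proj₂ (G.components k')) p q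

    γ-pair : ∀ p q → γ (G.pair p q) ≡ label p q
    γ-pair p q = cong (λ r → label (proj₁ r) (proj₂ r)) (G.components-pair p q)

    γ≤y : ∀ k → γ k ⊑ y
    γ≤y k = label≤y (proj₁ (G.components k)) (proj₂ (G.components k))

    ⊥G : Carrier G.poset
    ⊥G = G.pair bot bot

    ⊥G-least : ∀ k → _≤_ G.poset ⊥G k
    ⊥G-least k = G.pair-≤ k bot bot (tt , tt)

    γ-⊥G : γ ⊥G ≡ x
    γ-⊥G = γ-pair bot bot

  module Glue (ν : Unifier P) (l₀ t : Carrier (L ν))
    (ν-l₀ : map ν l₀ ≡ x) (ν-t : map ν t ≡ y) (n : ℕ) where
    open Gadget n
    private
      L' = L ν
      module L' = PO L'
      module G' = PO G.poset
      join-t : ∀ l → ∃ (IsJoinIn L' (λ _ → ⊤) l t)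
      join-t l = proj₁ (lattice ν l t tt tt)

    _∨t : Carrier L' → Carrier L'
    l ∨t = proj₁ (join-t l)

    ≤∨t : ∀ l → _≤_ L' l (l ∨t)
    ≤∨t l = proj₁ (proj₂ (proj₂ (join-t l)))

    t≤∨t : ∀ l → _≤_ L' t (l ∨t)
    t≤∨t l = proj₁ (proj₂ (proj₂ (proj₂ (join-t l))))

    ∨t-mono : ∀ l l' → _≤_ L' l l' → _≤_ L' (l ∨t) (l' ∨t)
    ∨t-mono l l' l≤l' =
      proj₂ (proj₂ (proj₂ (proj₂ (join-t l)))) (l' ∨t) tt (L'.≤-trans l≤l' (≤∨t l')) (t≤∨t l')

    glue : (l : Carrier L') (k : Carrier G.poset) → Dec (k ≡ ⊥G) → Dec (map ν l ⊑ x) → Carrier P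
    glue l k (yes _) _ = map ν l
    glue l k (no _) (yes _) = γ k
    glue l k (no _) (no _) = map ν (l ∨t)

    glue-mono : ∀ l l' k k' → _≤_ L' l l' → _≤_ G.poset k k' → ∀ dk dl dk' dl' →
                glue l k dk dl ⊑ glue l' k' dk' dl'
    glue-mono l l' k k' l≤l' k≤k' (yes _) _ (yes _) _ = monotone ν _ _ l≤l'
    glue-mono l l' k k' l≤l' k≤k' (yes _) _ (no _) (yes l'≤x) =
      ≤-trans (monotone ν _ _ l≤l') (≤-trans l'≤x (subst (_⊑ γ k') γ-⊥G (γ-mono ⊥G k' (⊥G-least k'))))
    glue-mono l l' k k' l≤l' k≤k' (yes _) _ (no _) (no _) = monotone ν _ _ (L'.≤-trans l≤l' (≤∨t l'))
    glue-mono l l' k k' l≤l' k≤k' (no k≢⊥) _ (yes refl) _ = ⊥-elim (k≢⊥ (G'.≤-antisym k≤k' (⊥G-least k)))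
    glue-mono l l' k k' l≤l' k≤k' (no _) (yes _) (no _) (yes _) = γ-mono k k' k≤k'
    glue-mono l l' k k' l≤l' k≤k' (no _) (yes _) (no _) (no _) =
      ≤-trans (γ≤y k) (subst (_⊑ map ν (l' ∨t)) ν-t (monotone ν _ _ (t≤∨t l')))
    glue-mono l l' k k' l≤l' k≤k' (no _) (no l≰x) (no _) (yes l'≤x) =
      ⊥-elim (l≰x (≤-trans (monotone ν _ _ l≤l') l'≤x))
    glue-mono l l' k k' l≤l' k≤k' (no _) (no _) (no _) (no _) = monotone ν _ _ (∨t-mono l l' l≤l')

    glued-map : Carrier L' → Carrier G.poset → Carrier P
    glued-map l k = glue l k (k F.≟ ⊥G) (_≤?_ P (map ν l) x)

    module LG = Product L' G.poset

    glued : Unifier P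
    glued = record
      { L = LG.poset
      ; lattice = LG.isLattice (lattice ν) (G.isLattice (flat-lattice n) (flat-lattice n))
      ; nonempty = LG.pair l₀ ⊥G
      ; map = λ z → glued-map (proj₁ (LG.components z)) (proj₂ (LG.components z))
      ; monotone = λ z w (l≤l' , k≤k') →
          let (l , k) = LG.components z ; (l' , k') = LG.components w
          in glue-mono l l' k k' l≤l' k≤k' (k F.≟ ⊥G) (_≤?_ P (map ν l) x) (k' F.≟ ⊥G) (_≤?_ P (map ν l') x) }

    glued-pair : ∀ l k → map glued (LG.pair l k) ≡ glued-map l k
    glued-pair l k = cong (λ r → glued-map (proj₁ r) (proj₂ r)) (LG.components-pair l k)

    below-glued : ν ≼ glued
    below-glued = (λ l → LG.pair l ⊥G) , (λ l l' l≤l' → LG.pair-mono l≤l' (G'.≤-refl {⊥G})) ,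
                  λ l → trans (glued-pair l ⊥G) (on-⊥G l)
      where
      on-⊥G : ∀ l → glued-map l ⊥G ≡ map ν l
      on-⊥G l with ⊥G F.≟ ⊥G
      ... | yes _ = refl
      ... | no ⊥G≢⊥G = ⊥-elim (⊥G≢⊥G refl)

    glued-over-l₀ : ∀ p q → map glued (LG.pair l₀ (G.pair p q)) ≡ label p q
    glued-over-l₀ p q = trans (glued-pair l₀ (G.pair p q)) (trans (over-l₀ (G.pair p q)) (γ-pair p q))
      where
      over-l₀ : ∀ k → glued-map l₀ k ≡ γ k
      over-l₀ k with k F.≟ ⊥G
      ... | yes refl = trans ν-l₀ (sym γ-⊥G)
      ... | no _ with _≤?_ P (map ν l₀) x
      ...   | yes _ = refl
      ...   | no l₀≰x = ⊥-elim (l₀≰x (subst (_⊑ x) (sym ν-l₀) (≤-refl {x})))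

    -- If the gadget has more atoms than L has elements, the glued unifier
    -- does not factor back through ν: two atoms on the first axis would be
    -- identified, and the join of their common image with the image of an
    -- atom on the second axis would lie between a, b and both c and d.
    noRetraction : size L' ℕ.< n → (h : Carrier LG.poset → Carrier L') →
                   Monotone LG.poset L' h → (∀ z → map ν (h z) ≡ map glued z) → ⊥
    noRetraction big h h-mono h-comm =
      let (r , s , r<s , collide) = FP.pigeonhole big (λ r → h (at (atom r) bot))
      in squeezed r s r<s collide
      where
      at : Fin (suc (suc n)) → Fin (suc (suc n)) → Carrier LG.poset
      at p q = LG.pair l₀ (G.pair p q)

      h-at-mono : ∀ p q p' q' → p ⊑ₘ p' → q ⊑ₘ q' → _≤_ L' (h (at p q)) (h (at p' q'))
      h-at-mono _ _ _ _ p⊑p' q⊑q' = h-mono _ _ (LG.pair-mono (L'.≤-refl {l₀}) (G.pair-mono p⊑p' q⊑q'))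

      h-label : ∀ p q → map ν (h (at p q)) ≡ label p q
      h-label p q = trans (h-comm (at p q)) (glued-over-l₀ p q)

      label≤ν : ∀ p q {l} → _≤_ L' (h (at p q)) l → label p q ⊑ map ν l
      label≤ν p q {l} h≤l = subst (_⊑ map ν l) (h-label p q) (monotone ν _ _ h≤l)

      ν≤label : ∀ p q {l} → _≤_ L' l (h (at p q)) → map ν l ⊑ label p q
      ν≤label p q {l} l≤h = subst (map ν l ⊑_) (h-label p q) (monotone ν _ _ l≤h)

      squeezed : ∀ r s → r F.< s → h (at (atom r) bot) ≡ h (at (atom s) bot) → ⊥
      squeezed r s r<s collide with proj₁ (lattice ν (h (at (atom r) bot)) (h (at bot (atom s))) tt tt)
      ... | (j , _ , r≤j , s≤j , j-least) =
        separated (map ν j) (label≤ν (atom r) bot r≤j) (label≤ν bot (atom s) s≤j)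
          (subst (map ν j ⊑_) (cOrD-< r<s) (ν≤label (atom r) (atom s) j≤rs))
          (subst (map ν j ⊑_) (cOrD-diag s) (ν≤label (atom s) (atom s) j≤ss))
        where
        j≤rs : _≤_ L' j (h (at (atom r) (atom s)))
        j≤rs = j-least _ tt (h-at-mono (atom r) bot (atom r) (atom s) refl tt)
                            (h-at-mono bot (atom s) (atom r) (atom s) tt refl)
        j≤ss : _≤_ L' j (h (at (atom s) (atom s)))
        j≤ss = j-least _ tt
          (subst (λ l → _≤_ L' l (h (at (atom s) (atom s)))) (sym collide)
                 (h-at-mono (atom s) bot (atom s) (atom s) refl tt))
          (h-at-mono bot (atom s) (atom s) (atom s) tt refl)

  xyChain : Unifier P
  xyChain = record
    { L = chain 2 ; lattice = chain-lattice 2 ; nonempty = zero ; map = endpoint ; monotone = endpoint-mono }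
    where
    endpoint : Fin 2 → Carrier P
    endpoint zero = x
    endpoint (suc _) = y
    endpoint-mono : Monotone (chain 2) P endpoint
    endpoint-mono zero zero _ = ≤-refl
    endpoint-mono zero (suc _) _ = x≤y
    endpoint-mono (suc _) (suc _) _ = ≤-refl

  -- The member ν above the chain x < y lies
  -- below its glued unifier, which lies below some member; incomparability
  -- forces that member to be ν itself, contradicting noRetraction.
  noMuSet : HasMuSet P → ⊥
  noMuSet (I , μ , incomparable , complete) =
    let (i , f , _ , f-comm) = complete xyChain in refute i f f-comm
    where
    refute : (i : I) (f : Fin 2 → Carrier (L (μ i))) → (∀ z → map (μ i) (f z) ≡ map xyChain z) → ⊥
    refute i f f-comm = W.noRetraction (ℕP.n<1+n _) h h-mono h-comm
      where
      module W = Glue (μ i) (f zero) (f (suc zero)) (f-comm zero) (f-comm (suc zero)) (suc (size (L (μ i))))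
      above = complete W.glued
      i≡j : i ≡ proj₁ above
      i≡j = incomparable i (proj₁ above)
              (≼-trans {u = μ i} {v = W.glued} {w = μ (proj₁ above)} W.below-glued (proj₂ above))
      back : W.glued ≼ μ i
      back = subst (λ k → W.glued ≼ μ k) (sym i≡j) (proj₂ above)
      h = proj₁ back
      h-mono = proj₁ (proj₂ back)
      h-comm = proj₂ (proj₂ back)

-- Take a minimal upper bound c of a, b in [x, y].  If some upper
-- bound w is not above c, take a minimal upper bound d below w; then no
-- element lies between a, b and both c, d, which is the obstruction.
module IntervalJoin (P : FinPoset) (muSet : HasMuSet P) {x y a b : Carrier P}
  (x≤a : _≤_ P x a) (a≤y : _≤_ P a y) (x≤b : _≤_ P x b) (b≤y : _≤_ P b y) where
  open PO P

  UpperBound : Carrier P → Set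
  UpperBound z = Interval P x y z × _≤_ P a z × _≤_ P b z

  UpperBound? : ∀ z → Dec (UpperBound z)
  UpperBound? z = (_≤?_ P x z ×-dec _≤?_ P z y) ×-dec _≤?_ P a z ×-dec _≤?_ P b z

  minimalUpperBound : ∀ w → UpperBound w → ∃ λ m → IsMinimalIn P UpperBound m × _≤_ P m w
  minimalUpperBound = minimalBelow P UpperBound UpperBound?

  lowestUpperBound = minimalUpperBound y ((≤-trans x≤a a≤y , ≤-refl) , a≤y , b≤y)

  c : Carrier P
  c = proj₁ lowestUpperBound

  c-upper : UpperBound c
  c-upper = proj₁ (proj₁ (proj₂ lowestUpperBound))

  c-minimal : ∀ z → UpperBound z → _≤_ P z c → z ≡ c
  c-minimal = proj₂ (proj₁ (proj₂ lowestUpperBound))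

  -- An upper bound w not above c yields the forbidden configuration: with d a
  -- minimal upper bound below w, anything between a, b and both c, d equals
  -- both c and d, so c = d ≤ w.
  notAboveC : ∀ w → UpperBound w → ¬ _≤_ P c w → ⊥
  notAboveC w UBw c≰w with minimalUpperBound w UBw
  ... | d , (((_ , d≤y) , a≤d , b≤d) , d-minimal) , d≤w =
    Obstruction.noMuSet P x a b c d y x≤a x≤b a≤c b≤c a≤d b≤d c≤y d≤y separated muSet
    where
    a≤c = proj₁ (proj₂ c-upper)
    b≤c = proj₂ (proj₂ c-upper)
    c≤y = proj₂ (proj₁ c-upper)
    separated : ∀ z → _≤_ P a z → _≤_ P b z → _≤_ P z c → _≤_ P z d → ⊥
    separated z a≤z b≤z z≤c z≤d = c≰w (subst (λ v → _≤_ P v w) d≡c d≤w)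
      where
      UBz : UpperBound z
      UBz = (≤-trans x≤a a≤z , ≤-trans z≤c c≤y) , a≤z , b≤z
      d≡c : d ≡ c
      d≡c = trans (sym (d-minimal z UBz z≤d)) (c-minimal z UBz z≤c)

  join : ∃ (IsJoinIn P (Interval P x y) a b)
  join = c , proj₁ c-upper , proj₁ (proj₂ c-upper) , proj₂ (proj₂ c-upper) , least
    where
    least : ∀ w → Interval P x y w → _≤_ P a w → _≤_ P b w → _≤_ P c w
    least w Iw a≤w b≤w = decidable-stable (_≤?_ P c w) (notAboveC w (Iw , a≤w , b≤w))

dualJoin⇒meet : (P : FinPoset) {x y a b : Carrier P} →
  ∃ (IsJoinIn (P ᵒᵖ) (Interval (P ᵒᵖ) y x) a b) → ∃ (IsMeetIn P (Interval P x y) a b)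
dualJoin⇒meet P (m , Im , m≤a , m≤b , greatest) = m , swap Im , m≤a , m≤b , λ w Iw → greatest w (swap Iw)

-- Meets are joins in the dual poset, which inherits the μ-set.
muSet⇒intervalsAreLattices : (P : FinPoset) → HasMuSet P → IntervalsAreLattices P
muSet⇒intervalsAreLattices P muSet x y _ a b (x≤a , a≤y) (x≤b , b≤y) =
  IntervalJoin.join P muSet x≤a a≤y x≤b b≤y ,
  dualJoin⇒meet P (IntervalJoin.join (P ᵒᵖ) (dualMuSet muSet) a≤y x≤a b≤y x≤b)

-- For p ≤ q with [p, q] a lattice, the interval unifier for [p, q]: re-order
-- P so that the elements outside [p, q] form a chain below the interval, and
-- retract everything outside onto p.  Every unifier with image inside [p, q]
-- factors through it.
module IntervalUnifier (P : FinPoset) {p q : Carrier P} (p≤q : _≤_ P p q)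
  (interval-lattice : IsLatticeOn P (Interval P p q)) where
  open PO P

  In : Carrier P → Set
  In = Interval P p q

  In? : ∀ z → Dec (In z)
  In? z = _≤?_ P p z ×-dec _≤?_ P z q

  data _⊴_ (z w : Carrier P) : Set where
    out-out : ¬ In z → ¬ In w → z F.≤ w → z ⊴ w
    out-in  : ¬ In z → In w → z ⊴ w
    in-in   : In z → In w → _≤_ P z w → z ⊴ w

  ⊴-refl : ∀ z → z ⊴ z
  ⊴-refl z with In? z
  ... | yes Iz = in-in Iz Iz ≤-refl
  ... | no ¬Iz = out-out ¬Iz ¬Iz FP.≤-refl

  ⊴-trans : ∀ {z w v} → z ⊴ w → w ⊴ v → z ⊴ v
  ⊴-trans (out-out ¬Iz _ z≤w) (out-out _ ¬Iv w≤v) = out-out ¬Iz ¬Iv (FP.≤-trans z≤w w≤v)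
  ⊴-trans (out-out ¬Iz _ _) (out-in _ Iv) = out-in ¬Iz Iv
  ⊴-trans (out-in ¬Iz _) (in-in _ Iv _) = out-in ¬Iz Iv
  ⊴-trans (in-in Iz _ z≤w) (in-in _ Iv w≤v) = in-in Iz Iv (≤-trans z≤w w≤v)
  ⊴-trans (out-out _ ¬Iw _) (in-in Iw _ _) = ⊥-elim (¬Iw Iw)
  ⊴-trans (out-in _ Iw) (out-out ¬Iw _ _) = ⊥-elim (¬Iw Iw)
  ⊴-trans (out-in _ Iw) (out-in ¬Iw _) = ⊥-elim (¬Iw Iw)
  ⊴-trans (in-in _ Iw _) (out-out ¬Iw _ _) = ⊥-elim (¬Iw Iw)
  ⊴-trans (in-in _ Iw _) (out-in ¬Iw _) = ⊥-elim (¬Iw Iw)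

  ⊴-up : ∀ {z w} → z ⊴ w → In z → In w
  ⊴-up (out-out ¬Iz _ _) Iz = ⊥-elim (¬Iz Iz)
  ⊴-up (out-in _ Iw) _ = Iw
  ⊴-up (in-in _ Iw _) _ = Iw

  ⊴-antisym : ∀ {z w} → z ⊴ w → w ⊴ z → z ≡ w
  ⊴-antisym (out-out _ _ z≤w) (out-out _ _ w≤z) = FP.≤-antisym z≤w w≤z
  ⊴-antisym (in-in _ _ z≤w) (in-in _ _ w≤z) = ≤-antisym z≤w w≤z
  ⊴-antisym (out-in ¬Iz Iw) w⊴z = ⊥-elim (¬Iz (⊴-up w⊴z Iw))
  ⊴-antisym (out-out ¬Iz _ _) (out-in _ Iz) = ⊥-elim (¬Iz Iz)
  ⊴-antisym (out-out _ ¬Iw _) (in-in Iw _ _) = ⊥-elim (¬Iw Iw)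
  ⊴-antisym (in-in _ Iw _) (out-out ¬Iw _ _) = ⊥-elim (¬Iw Iw)
  ⊴-antisym (in-in _ Iw _) (out-in ¬Iw _) = ⊥-elim (¬Iw Iw)

  ⊴-dec : ∀ z w → Dec (z ⊴ w)
  ⊴-dec z w with In? z | In? w
  ... | yes Iz | yes Iw with _≤?_ P z w
  ...   | yes z≤w = yes (in-in Iz Iw z≤w)
  ...   | no z≰w = no λ { (out-out ¬Iz _ _) → ¬Iz Iz ; (out-in ¬Iz _) → ¬Iz Iz ; (in-in _ _ z≤w) → z≰w z≤w }
  ⊴-dec z w | yes Iz | no ¬Iw = no λ z⊴w → ¬Iw (⊴-up z⊴w Iz)
  ⊴-dec z w | no ¬Iz | yes Iw = yes (out-in ¬Iz Iw)
  ⊴-dec z w | no ¬Iz | no ¬Iw with z F.≤? w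
  ...   | yes z≤w = yes (out-out ¬Iz ¬Iw z≤w)
  ...   | no z≰w = no λ { (out-out _ _ z≤w) → z≰w z≤w ; (out-in _ Iw) → ¬Iw Iw ; (in-in _ Iw _) → ¬Iw Iw }

  reordered : FinPoset
  reordered = record
    { size = size P
    ; _≤_ = _⊴_
    ; isPO = record
      { isPreorder = record
        { isEquivalence = isEquivalence
        ; reflexive = λ { {z} refl → ⊴-refl z }
        ; trans = ⊴-trans }
      ; antisym = ⊴-antisym }
    ; _≤?_ = ⊴-dec }

  ⊴-down : ∀ {v w} → v ⊴ w → In w → ¬ In v ⊎ (In v × _≤_ P v w)
  ⊴-down (out-out _ ¬Iw _) Iw = ⊥-elim (¬Iw Iw)
  ⊴-down (out-in ¬Iv _) _ = inj₁ ¬Iv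
  ⊴-down (in-in Iv _ v≤w) _ = inj₂ (Iv , v≤w)

  ⊴-within : ∀ {z w} → z ⊴ w → In z → _≤_ P z w
  ⊴-within (out-out ¬Iz _ _) Iz = ⊥-elim (¬Iz Iz)
  ⊴-within (out-in ¬Iz _) Iz = ⊥-elim (¬Iz Iz)
  ⊴-within (in-in _ _ z≤w) _ = z≤w

  reordered-lattice : IsLattice reordered
  reordered-lattice z w _ _ with In? z | In? w
  ... | yes Iz | yes Iw = join (proj₁ (interval-lattice z w Iz Iw)) , meet (proj₂ (interval-lattice z w Iz Iw))
    where
    join : ∃ (IsJoinIn P In z w) → ∃ (IsJoinIn reordered (λ _ → ⊤) z w)
    join (j , Ij , z≤j , w≤j , least) =
      j , tt , in-in Iz Ij z≤j , in-in Iw Ij w≤j ,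
      λ v _ z⊴v w⊴v → in-in Ij (⊴-up z⊴v Iz) (least v (⊴-up z⊴v Iz) (⊴-within z⊴v Iz) (⊴-within w⊴v Iw))
    meet : ∃ (IsMeetIn P In z w) → ∃ (IsMeetIn reordered (λ _ → ⊤) z w)
    meet (m , Im , m≤z , m≤w , greatest) = m , tt , in-in Im Iz m≤z , in-in Im Iw m≤w , below-m
      where
      below-m : ∀ v → ⊤ → v ⊴ z → v ⊴ w → v ⊴ m
      below-m v _ v⊴z v⊴w with ⊴-down v⊴z Iz
      ... | inj₁ ¬Iv = out-in ¬Iv Im
      ... | inj₂ (Iv , v≤z) = in-in Iv Im (greatest v Iv v≤z (⊴-within v⊴w Iv))
  ... | yes Iz | no ¬Iw = comparable-lattice reordered (inj₂ (out-in ¬Iw Iz))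
  ... | no ¬Iz | yes Iw = comparable-lattice reordered (inj₁ (out-in ¬Iz Iw))
  ... | no ¬Iz | no ¬Iw with FP.≤-total z w
  ...   | inj₁ z≤w = comparable-lattice reordered (inj₁ (out-out ¬Iz ¬Iw z≤w))
  ...   | inj₂ w≤z = comparable-lattice reordered (inj₂ (out-out ¬Iw ¬Iz w≤z))

  retract : Carrier P → Carrier P
  retract z with In? z
  ... | yes _ = z
  ... | no _ = p

  retract-mono : Monotone reordered P retract
  retract-mono z w z⊴w with In? z | In? w
  ... | yes Iz | yes _ = ⊴-within z⊴w Iz
  ... | yes Iz | no ¬Iw = ⊥-elim (¬Iw (⊴-up z⊴w Iz))
  ... | no _ | yes Iw = proj₁ Iw
  ... | no _ | no _ = ≤-refl

  retract-in : ∀ z → In (retract z)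
  retract-in z with In? z
  ... | yes Iz = Iz
  ... | no _ = ≤-refl , p≤q

  retract-fixes : ∀ z → In z → retract z ≡ z
  retract-fixes z Iz with In? z
  ... | yes _ = refl
  ... | no ¬Iz = ⊥-elim (¬Iz Iz)

  unifier : Unifier P
  unifier = record
    { L = reordered ; lattice = reordered-lattice ; nonempty = p ; map = retract ; monotone = retract-mono }

  factor : (u : Unifier P) → (∀ l → In (map u l)) → u ≼ unifier
  factor u inside =
    map u , (λ l l' l≤l' → in-in (inside l) (inside l') (monotone u l l' l≤l')) ,
    λ l → retract-fixes (map u l) (inside l)

lookup-injective : ∀ {A : Set} {xs : List A} → Unique xs → ∀ i j → lookup xs i ≡ lookup xs j → i ≡ j
lookup-injective (_ AllPairs.∷ _) zero zero _ = refl
lookup-injective (x∉xs AllPairs.∷ _) zero (suc j) eq = ⊥-elim (All.lookup x∉xs (∈-lookup j) eq)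
lookup-injective (x∉xs AllPairs.∷ _) (suc i) zero eq = ⊥-elim (All.lookup x∉xs (∈-lookup i) (sym eq))
lookup-injective (_ AllPairs.∷ unique) (suc i) (suc j) eq = cong suc (lookup-injective unique i j eq)

-- When all intervals are lattices, the interval unifiers of the intervals
-- [p, q] with p minimal and q maximal form a μ-set: every unifier has image
-- inside [u ⊥, u ⊤], which lies inside one of these intervals, and the
-- extremal endpoints make distinct members incomparable.
module Canonical (P : FinPoset) (intervals : IntervalsAreLattices P) where
  open PO P

  Extremal : Carrier P × Carrier P → Set
  Extremal (p , q) = IsMinimal P p × IsMaximal P q × _≤_ P p q

  Extremal? : ∀ pq → Dec (Extremal pq)
  Extremal? (p , q) =
    FP.all? (λ z → _≤?_ P z p →-dec (z F.≟ p)) ×-dec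
    FP.all? (λ z → _≤?_ P q z →-dec (z F.≟ q)) ×-dec
    _≤?_ P p q

  extremalPairs : List (Carrier P × Carrier P)
  extremalPairs = filter Extremal? (cartesianProduct (allFin (size P)) (allFin (size P)))

  k : ℕ
  k = length extremalPairs

  pairAt : Fin k → Carrier P × Carrier P
  pairAt = lookup extremalPairs

  pairAt-injective : ∀ i j → pairAt i ≡ pairAt j → i ≡ j
  pairAt-injective = lookup-injective
    (Unique.filter⁺ Extremal? (Unique.cartesianProduct⁺ (Unique.allFin⁺ _) (Unique.allFin⁺ _)))

  pairAt-extremal : ∀ j → Extremal (pairAt j)
  pairAt-extremal j =
    proj₂ (∈-filter⁻ Extremal? {xs = cartesianProduct (allFin _) (allFin _)} (∈-lookup j))

  low high : Fin k → Carrier P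
  low j = proj₁ (pairAt j)
  high j = proj₂ (pairAt j)

  low≤high : ∀ j → _≤_ P (low j) (high j)
  low≤high j = proj₂ (proj₂ (pairAt-extremal j))

  module Iv (j : Fin k) = IntervalUnifier P (low≤high j) (intervals (low j) (high j) (low≤high j))

  ν : Fin k → Unifier P
  ν j = Iv.unifier j

  enclose : ∀ {p₀ q₀} → _≤_ P p₀ q₀ → ∃ λ j → _≤_ P (low j) p₀ × _≤_ P q₀ (high j)
  enclose {p₀} {q₀} p₀≤q₀ =
    Any.index listed ,
    subst (λ (p , q) → _≤_ P p p₀ × _≤_ P q₀ q) (lookup-index listed) (p≤p₀ , q₀≤q)
    where
    below = minimalElementBelow P p₀
    above = minimalElementBelow (P ᵒᵖ) q₀
    p = proj₁ below
    q = proj₁ above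
    p≤p₀ = proj₂ (proj₂ below)
    q₀≤q = proj₂ (proj₂ above)
    listed = ∈-filter⁺ Extremal? (∈-cartesianProduct⁺ (∈-allFin p) (∈-allFin q))
               (proj₁ (proj₂ below) , proj₁ (proj₂ above) , ≤-trans p≤p₀ (≤-trans p₀≤q₀ q₀≤q))

  complete : ∀ (u : Unifier P) → ∃ λ j → u ≼ ν j
  complete u = j , Iv.factor j u inside
    where
    ⊥u = latticeBottom (L u) (lattice u) (nonempty u)
    ⊤u = latticeTop (L u) (lattice u) (nonempty u)
    enclosing = enclose (monotone u _ _ (proj₂ ⊥u (proj₁ ⊤u)))
    j = proj₁ enclosing
    inside : ∀ l → Interval P (low j) (high j) (map u l)
    inside l = ≤-trans (proj₁ (proj₂ enclosing)) (monotone u _ _ (proj₂ ⊥u l)) ,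
               ≤-trans (monotone u _ _ (proj₂ ⊤u l)) (proj₂ (proj₂ enclosing))

  -- The endpoints of [low i, high i] are hit by ν i, so a factorisation
  -- through ν j puts them inside [low j, high j]; extremality forces equality.
  incomparable : ∀ i j → ν i ≼ ν j → i ≡ j
  incomparable i j (f , _ , f-comm) =
    pairAt-injective i j
      (cong₂ _,_ (sym (minimal-i _ (proj₁ low-inside))) (sym (maximal-i _ (proj₂ high-inside))))
    where
    minimal-i = proj₁ (pairAt-extremal i)
    maximal-i = proj₁ (proj₂ (pairAt-extremal i))
    hit : ∀ z → Interval P (low i) (high i) z → Interval P (low j) (high j) z
    hit z Iz = subst (Interval P (low j) (high j))
                 (trans (f-comm z) (Iv.retract-fixes i z Iz)) (Iv.retract-in j (f z))
    low-inside = hit (low i) (≤-refl , low≤high i)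
    high-inside = hit (high i) (low≤high i , ≤-refl)

  isMuSet : IsMuSet ν
  isMuSet = incomparable , complete

  -- With at most one extremal interval, P is that interval, hence a lattice.
  single⇒lattice : Carrier P → Irrelevant (Fin k) → IsLattice P
  single⇒lattice e single =
    everywhere-lattice P inside (intervals (low j₀) (high j₀) (low≤high j₀))
    where
    j₀ = proj₁ (enclose (≤-refl {e}))
    inside : ∀ z → Interval P (low j₀) (high j₀) z
    inside z = let (j , low≤z , z≤high) = enclose (≤-refl {z})
               in subst (λ j → Interval P (low j) (high j) z) (single j j₀) (low≤z , z≤high)

↔-irrelevant : ∀ {A B : Set} → A ↔ B → Irrelevant B → Irrelevant A
↔-irrelevant A↔B irrelevant a a' =
  trans (sym (strictlyInverseʳ a)) (trans (cong from (irrelevant (to a) (to a'))) (strictlyInverseʳ a'))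
  where open Inverse A↔B

Fin-irrelevant : ∀ {k} → k ℕ.≤ 1 → Irrelevant (Fin k)
Fin-irrelevant (ℕ.s≤s ℕ.z≤n) zero zero = refl

Fin-relevant : ∀ {k} → k ≥ 2 → ¬ Irrelevant (Fin k)
Fin-relevant (ℕ.s≤s (ℕ.s≤s _)) irrelevant with irrelevant zero (suc zero)
... | ()

identityUnifier : (P : FinPoset) → IsLattice P → Carrier P → Unifier P
identityUnifier P lat e = record
  { L = P ; lattice = lat ; nonempty = e ; map = λ z → z ; monotone = λ _ _ a≤b → a≤b }

identityMuSet : (P : FinPoset) (lat : IsLattice P) (e : Carrier P) →
  IsMuSet {P} {⊤} (λ _ → identityUnifier P lat e)
identityMuSet P lat e = (λ _ _ _ → refl) , λ u → tt , map u , monotone u , λ _ → refl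

-- If some μ-set has at most one member, so does every μ-set: any two members
-- of the second lie below the single member of the first, which lies below
-- some member of the second, and incomparability identifies them.
μ-singleton : ∀ {P : FinPoset} {I J : Set} (μ : I → Unifier P) (ν : J → Unifier P) →
  IsMuSet μ → IsMuSet ν → Irrelevant I → Irrelevant J
μ-singleton μ ν (_ , μ-complete) (ν-incomparable , ν-complete) single j j'
  with μ-complete (ν j) | μ-complete (ν j')
... | (i , j≼i) | (i' , j'≼i') with single i' i
... | refl with ν-complete (μ i)
... | (j″ , i≼j″) =
  trans (ν-incomparable j j″ (≼-trans {u = ν j} {v = μ i} {w = ν j″} j≼i i≼j″))
        (sym (ν-incomparable j' j″ (≼-trans {u = ν j'} {v = μ i} {w = ν j″} j'≼i' i≼j″)))

module Classification (P : FinPoset) (e : Carrier P) where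

  lattice⇒type1 : IsLattice P → Type1 P
  lattice⇒type1 lat = ⊤ , (λ _ → identityUnifier P lat e) , identityMuSet P lat e ,
                      mk↔ₛ′ (λ _ → zero) (λ _ → tt) (λ { zero → refl }) (λ _ → refl)

  -- A one-element μ-set forces the canonical μ-set to be a singleton.
  type1⇒lattice : Type1 P → IsLattice P
  type1⇒lattice (I , μ , isMuSet , I↔1) =
    single⇒lattice e (μ-singleton μ ν isMuSet canonical (↔-irrelevant I↔1 (Fin-irrelevant ℕP.≤-refl)))
    where open Canonical P (muSet⇒intervalsAreLattices P (I , μ , isMuSet)) renaming (isMuSet to canonical)

  intervals⇒typeω : ¬ IsLattice P → IntervalsAreLattices P → Typeω P
  intervals⇒typeω ¬lat intervals = Fin k , ν , isMuSet , k , atLeastTwo ,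
                                   mk↔ₛ′ (λ j → j) (λ j → j) (λ _ → refl) (λ _ → refl)
    where
    open Canonical P intervals
    atLeastTwo : k ≥ 2
    atLeastTwo = decidable-stable (2 ℕ.≤? k)
      (λ k≱2 → ¬lat (single⇒lattice e (Fin-irrelevant (ℕP.≤-pred (ℕP.≰⇒> k≱2)))))

  -- A lattice has a singleton μ-set, so no μ-set with two members.
  typeω⇒intervals : Typeω P → ¬ IsLattice P × IntervalsAreLattices P
  typeω⇒intervals (I , μ , isMuSet , n , n≥2 , I↔n) =
    (λ lat → Fin-relevant n≥2 (↔-irrelevant (↔-sym I↔n)
      (μ-singleton (λ _ → identityUnifier P lat e) μ (identityMuSet P lat e) isMuSet (λ _ _ → refl)))) ,
    muSet⇒intervalsAreLattices P (I , μ , isMuSet)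

  -- Lattices and non-lattices with lattice intervals both have μ-sets, and
  -- any μ-set makes all intervals lattices.
  type0⇔neither : Type0 P ⇔ (¬ (IsLattice P ⊎ (¬ IsLattice P × IntervalsAreLattices P)))
  type0⇔neither = mk⇔ type0⇒neither neither⇒type0
    where
    type0⇒neither : Type0 P → ¬ (IsLattice P ⊎ (¬ IsLattice P × IntervalsAreLattices P))
    type0⇒neither noMuSet (inj₁ lat) =
      let (I , μ , isMuSet , _) = lattice⇒type1 lat in noMuSet (I , μ , isMuSet)
    type0⇒neither noMuSet (inj₂ (¬lat , intervals)) =
      let (I , μ , isMuSet , _) = intervals⇒typeω ¬lat intervals in noMuSet (I , μ , isMuSet)
    neither⇒type0 : ¬ (IsLattice P ⊎ (¬ IsLattice P × IntervalsAreLattices P)) → Type0 P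
    neither⇒type0 neither muSet =
      neither (inj₂ ((λ lat → neither (inj₁ lat)) , muSet⇒intervalsAreLattices P muSet))

theorem15 : (P : FinPoset) → NonEmpty P →
    (Type1 P ⇔ IsLattice P) ×
    (Typeω P ⇔ (¬ IsLattice P × IntervalsAreLattices P)) ×
    (Type0 P ⇔ (¬ (IsLattice P ⊎ (¬ IsLattice P × IntervalsAreLattices P))))
theorem15 P e =
  mk⇔ type1⇒lattice lattice⇒type1 ,
  mk⇔ typeω⇒intervals (λ (¬lat , intervals) → intervals⇒typeω ¬lat intervals) ,
  type0⇔neither
  where open Classification P e
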